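{- Let $m\ge 3$. Starting from the canonical coloring of $D_3(m)$, perform successively: (1) swap colors $(0,1)$ on the line $L_0=\{S=0,\ k=0\}$; (2) swap colors $(0,2)$ on the plane $P_0=\{S=0\}$; (3) swap colors $(0,1)$ on $P_0$; (4) swap colors $(0,1)$ on the line $L_1=\{S=1,\ k=0\}$; (5) swap colors $(0,2)$ on the plane $P_1=\{S=1\}$. Each of these five operations is a Kempe swap (its support is a union of cycles of the corresponding Kempe map of the current coloring), and the resulting triple is a coloring of $D_3(m)$.
   Context: $V=(\mathbb Z_m)^3$ with points written $(i,j,k)$; $e_1,e_2,e_3$ are the standard basis vectors; $D_3(m)$ has arcs $v\to v+e_1,v+e_2,v+e_3$ (mod $m$); $S(i,j,k)=i+j+k\pmod m$. A coloring is a triple $(f_0,f_1,f_2)$ of permutations of $V$ with $\{f_0(v),f_1(v),f_2(v)\}=\{v+e_1,v+e_2,v+e_3\}$ for all $v$. The canonical coloring is $f_0(v)=v+e_1$, $f_1(v)=v+e_2$, $f_2(v)=v+e_3$. For a coloring and colors $r\ne s$, the Kempe map is $\tau_{r,s}=f_s^{ -1}\circ f_r$; swapping colors $(r,s)$ on $X\subseteq V$ means replacing $f_r$ by $f_s$ and $f_s$ by $f_r$ at every vertex of $X$, leaving all else unchanged; this is a Kempe swap when $X$ is a union of cycles of $\tau_{r,s}$. -}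

module Defs where

open import Data.Nat using (ℕ; NonZero; _+_)
open import Data.Nat.DivMod using (_mod_)
open import Data.Fin using (Fin; toℕ; zero; suc)
open import Data.Fin.Properties using () renaming (_≟_ to _≟ᶠ_)
open import Data.Bool using (Bool; true; false; if_then_else_; _∧_)
open import Data.Product using (_×_; _,_; ∃)
open import Relation.Nullary.Decidable using (⌊_⌋)
open import Relation.Binary.PropositionalEquality using (_≡_)
open import Function.Definitions using (Bijective)
import Data.Nat as ℕ

module _ (m : ℕ) .{{_ : NonZero m}} where

  V : Set
  V = Fin m × Fin m × Fin m

  inc : Fin m → Fin m
  inc x = (toℕ x + 1) mod m

  -- v ↦ v + e₁, v + e₂, v + e₃ ; color index d : Fin 3 selects e_{d+1}
  shift : Fin 3 → V → V
  shift zero          (i , j , k) = (inc i , j , k)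
  shift (suc zero)    (i , j , k) = (i , inc j , k)
  shift (suc (suc zero)) (i , j , k) = (i , j , inc k)

  S : V → ℕ
  S (i , j , k) = toℕ ((toℕ i + toℕ j + toℕ k) mod m)

  Triple : Set
  Triple = Fin 3 → V → V

  -- a coloring: each f_c a permutation of V, and
  -- {f₀ v, f₁ v, f₂ v} = {v+e₁, v+e₂, v+e₃} as sets
  IsColoring : Triple → Set
  IsColoring f =
    (∀ c → Bijective _≡_ _≡_ (f c)) ×
    (∀ v → (∀ c → ∃ λ d → f c v ≡ shift d v) × (∀ d → ∃ λ c → f c v ≡ shift d v))

  canonical : Triple
  canonical = shift

  -- the graph of the Kempe map τ_{r,s} = f_s⁻¹ ∘ f_r :  τ v ≡ w  iff  f_s w ≡ f_r v
  KempeStep : Triple → Fin 3 → Fin 3 → V → V → Set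
  KempeStep f r s v w = f s w ≡ f r v

  -- X (a decidable subset, given by its indicator) is a union of cycles of τ_{r,s}:
  -- v ∈ X iff τ_{r,s}(v) ∈ X, for every v
  UnionOfCycles : Triple → Fin 3 → Fin 3 → (V → Bool) → Set
  UnionOfCycles f r s X = ∀ v w → KempeStep f r s v w → X v ≡ X w

  swap : Fin 3 → Fin 3 → (V → Bool) → Triple → Triple
  swap r s X f c v =
    if X v
    then (if ⌊ c ≟ᶠ r ⌋ then f s v else if ⌊ c ≟ᶠ s ⌋ then f r v else f c v)
    else f c v

  isZero : ℕ → Bool
  isZero n = ⌊ n ℕ.≟ 0 ⌋

  isOne : ℕ → Bool
  isOne n = ⌊ n ℕ.≟ 1 ⌋

  L₀ P₀ L₁ P₁ : V → Bool
  L₀ v@(i , j , k) = isZero (S v) ∧ isZero (toℕ k)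
  P₀ v = isZero (S v)
  L₁ v@(i , j , k) = isOne (S v) ∧ isZero (toℕ k)
  P₁ v = isOne (S v)

  c0 c1 c2 c3 c4 c5 : Triple
  c0 = canonical
  c1 = swap zero (suc zero) L₀ c0
  c2 = swap zero (suc (suc zero)) P₀ c1
  c3 = swap zero (suc zero) P₀ c2
  c4 = swap zero (suc zero) L₁ c3
  c5 = swap zero (suc (suc zero)) P₁ c4

  Claim : Set
  Claim =
    (IsColoring c0 × UnionOfCycles c0 zero (suc zero) L₀) ×
    (IsColoring c1 × UnionOfCycles c1 zero (suc (suc zero)) P₀) ×
    (IsColoring c2 × UnionOfCycles c2 zero (suc zero) P₀) ×
    (IsColoring c3 × UnionOfCycles c3 zero (suc zero) L₁) ×
    (IsColoring c4 × UnionOfCycles c4 zero (suc (suc zero)) P₁) ×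
    IsColoring c5

{-# OPTIONS --safe #-}

-- Every arc raises S by one, so each Kempe map τ_{r,s} preserves the level sets
-- of S, and the planes P₀, P₁ are unions of Kempe cycles of every coloring.  On
-- the lines the Kempe map of colors (0,1) is v ↦ v + e₁ − e₂, which also fixes k:
-- for L₀ this is the canonical coloring, and for L₁ the coloring is still
-- canonical on the level S = 1, since the first three swaps happen inside P₀.
-- Finally, swapping on a union of cycles X yields a coloring again: at a vertex
-- of X the colors are permuted by the transposition (r s), and each new f_c is
-- glued from two bijections that the cycle condition keeps from colliding.
module Submission where

open import Defs
open import Data.Nat as ℕ using (ℕ; NonZero; _≤_; _<_; _+_; _%_; _∸_; >-nonZero⁻¹)
open import Data.Nat.Properties using (+-assoc; m+[n∸m]≡n; m∸n+n≡m)
open import Data.Nat.DivMod using (_mod_; %-distribˡ-+; m%n%n≡m%n; [m+n]%n≡m%n; m<n⇒m%n≡m)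
open import Data.Nat.Tactic.RingSolver using (solve-∀)
open import Data.Fin using (Fin; toℕ; zero; suc)
open import Data.Fin.Properties using (toℕ-fromℕ<; toℕ-injective; toℕ<n; _≟_)
open import Data.Fin.Permutation using (Permutation′; _⟨$⟩ʳ_; _⟨$⟩ˡ_; inverseʳ; transpose)
  renaming (id to idₚ)
open import Data.Bool using (Bool; true; false; _∧_)
open import Data.Product using (_×_; _,_; ∃; proj₁)
open import Function using (_∘_)
open import Function.Bundles using (mk↔ₛ′; Bijection)
open import Function.Properties.Inverse using (↔⇒⤖)
open import Function.Definitions using (Bijective; Injective; StrictlySurjective)
open import Function.Consequences using (surjective⇒strictlySurjective)
open import Function.Consequences.Propositional using (strictlySurjective⇒surjective)
open import Relation.Binary.PropositionalEquality
open import Relation.Nullary using (Dec; yes; no)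
open import Relation.Nullary.Decidable using (dec-true; dec-false; ⌊_⌋)

transpose-matchˡ : ∀ {n} {i j k : Fin n} → k ≡ i → transpose i j ⟨$⟩ʳ k ≡ j
transpose-matchˡ {i = i} refl rewrite dec-true (i ≟ i) refl = refl

transpose-matchʳ : ∀ {n} {i j k : Fin n} → k ≡ j → transpose i j ⟨$⟩ʳ k ≡ i
transpose-matchʳ {i = i} {j} refl with j ≟ i
... | yes j≡i = j≡i
... | no _ rewrite dec-true (j ≟ j) refl = refl

transpose-fixes : ∀ {n} {i j k : Fin n} → k ≢ i → k ≢ j → transpose i j ⟨$⟩ʳ k ≡ k
transpose-fixes {i = i} {j} {k} k≢i k≢j
  rewrite dec-false (k ≟ i) k≢i | dec-false (k ≟ j) k≢j = refl

select-bijective : ∀ {A B : Set} (X : A → Bool) {g₁ g₂ h : A → B} →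
  Bijective _≡_ _≡_ g₁ → Bijective _≡_ _≡_ g₂ →
  (∀ {v w} → g₁ w ≡ g₂ v → X v ≡ X w) →
  (∀ {v} → X v ≡ true → h v ≡ g₁ v) → (∀ {v} → X v ≡ false → h v ≡ g₂ v) →
  Bijective _≡_ _≡_ h
select-bijective X {g₁} {g₂} {h} (inj₁ , surj₁) (inj₂ , surj₂) compatible h-in h-out =
  injective , strictlySurjective⇒surjective surjective
  where
  injective : Injective _≡_ _≡_ h
  injective {x} {y} hx≡hy with X x in x∈X | X y in y∈X
  ... | true  | true  = inj₁ (trans (sym (h-in x∈X)) (trans hx≡hy (h-in y∈X)))
  ... | false | false = inj₂ (trans (sym (h-out x∈X)) (trans hx≡hy (h-out y∈X)))
  ... | true  | false with () ← trans (sym y∈X)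
        (trans (compatible (trans (sym (h-in x∈X)) (trans hx≡hy (h-out y∈X)))) x∈X)
  ... | false | true  with () ← trans (sym x∈X)
        (trans (compatible (trans (sym (h-in y∈X)) (trans (sym hx≡hy) (h-out x∈X)))) y∈X)

  surjective : StrictlySurjective _≡_ h
  surjective y with surjective⇒strictlySurjective _≡_ refl surj₂ y
                  | surjective⇒strictlySurjective _≡_ refl surj₁ y
  ... | x , g₂x≡y | w , g₁w≡y with X x in x∈X
  ...   | false = x , trans (h-out x∈X) g₂x≡y
  ...   | true  = w , trans (h-in w∈X) g₁w≡y
    where
    w∈X : X w ≡ true
    w∈X = trans (sym (compatible (trans g₁w≡y (sym g₂x≡y)))) x∈X

+-cong-% : ∀ {a a′ b b′} d .{{_ : NonZero d}} →
  a % d ≡ a′ % d → b % d ≡ b′ % d → (a + b) % d ≡ (a′ + b′) % d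
+-cong-% {a} {a′} {b} {b′} d a≡a′ b≡b′ = begin
  (a + b) % d              ≡⟨ %-distribˡ-+ a b d ⟩
  (a % d + b % d) % d      ≡⟨ cong₂ (λ x y → (x + y) % d) a≡a′ b≡b′ ⟩
  (a′ % d + b′ % d) % d    ≡⟨ %-distribˡ-+ a′ b′ d ⟨
  (a′ + b′) % d            ∎
  where open ≡-Reasoning

[[m+n]%d+o]%d≡m : ∀ {m n o d} .{{_ : NonZero d}} → m < d → n + o ≡ d → ((m + n) % d + o) % d ≡ m
[[m+n]%d+o]%d≡m {m} {n} {o} {d} m<d n+o≡d = begin
  ((m + n) % d + o) % d  ≡⟨ +-cong-% d (m%n%n≡m%n (m + n) d) refl ⟩
  (m + n + o) % d        ≡⟨ cong (_% d) (trans (+-assoc m n o) (cong (m +_) n+o≡d)) ⟩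
  (m + d) % d            ≡⟨ [m+n]%n≡m%n m d ⟩
  m % d                  ≡⟨ m<n⇒m%n≡m m<d ⟩
  m                      ∎
  where open ≡-Reasoning

module _ (m : ℕ) .{{_ : NonZero m}} where

  open ≡-Reasoning

  toℕ-inc : ∀ x → toℕ (inc m x) ≡ (toℕ x + 1) % m
  toℕ-inc x = toℕ-fromℕ< _

  inc⁻¹ : Fin m → Fin m
  inc⁻¹ x = (toℕ x + (m ∸ 1)) mod m

  inc-inc⁻¹ : ∀ x → inc m (inc⁻¹ x) ≡ x
  inc-inc⁻¹ x = toℕ-injective (begin
    toℕ (inc m (inc⁻¹ x))            ≡⟨ toℕ-inc (inc⁻¹ x) ⟩
    (toℕ (inc⁻¹ x) + 1) % m          ≡⟨ cong (λ a → (a + 1) % m) (toℕ-fromℕ< _) ⟩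
    ((toℕ x + (m ∸ 1)) % m + 1) % m  ≡⟨ [[m+n]%d+o]%d≡m (toℕ<n x) (m∸n+n≡m (>-nonZero⁻¹ m)) ⟩
    toℕ x                            ∎)

  inc⁻¹-inc : ∀ x → inc⁻¹ (inc m x) ≡ x
  inc⁻¹-inc x = toℕ-injective (begin
    toℕ (inc⁻¹ (inc m x))                ≡⟨ toℕ-fromℕ< _ ⟩
    (toℕ (inc m x) + (m ∸ 1)) % m        ≡⟨ cong (λ a → (a + (m ∸ 1)) % m) (toℕ-inc x) ⟩
    ((toℕ x + 1) % m + (m ∸ 1)) % m      ≡⟨ [[m+n]%d+o]%d≡m (toℕ<n x) (m+[n∸m]≡n (>-nonZero⁻¹ m)) ⟩
    toℕ x                                ∎)

  inc-injective : Injective _≡_ _≡_ (inc m)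
  inc-injective {x} {y} incx≡incy = begin
    x                  ≡⟨ inc⁻¹-inc x ⟨
    inc⁻¹ (inc m x)    ≡⟨ cong inc⁻¹ incx≡incy ⟩
    inc⁻¹ (inc m y)    ≡⟨ inc⁻¹-inc y ⟩
    y                  ∎

  shift⁻¹ : Fin 3 → V m → V m
  shift⁻¹ zero             (i , j , k) = inc⁻¹ i , j , k
  shift⁻¹ (suc zero)       (i , j , k) = i , inc⁻¹ j , k
  shift⁻¹ (suc (suc zero)) (i , j , k) = i , j , inc⁻¹ k

  shift-shift⁻¹ : ∀ d v → shift m d (shift⁻¹ d v) ≡ v
  shift-shift⁻¹ zero             (i , j , k) = cong (λ x → x , j , k) (inc-inc⁻¹ i)
  shift-shift⁻¹ (suc zero)       (i , j , k) = cong (λ x → i , x , k) (inc-inc⁻¹ j)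
  shift-shift⁻¹ (suc (suc zero)) (i , j , k) = cong (λ x → i , j , x) (inc-inc⁻¹ k)

  shift⁻¹-shift : ∀ d v → shift⁻¹ d (shift m d v) ≡ v
  shift⁻¹-shift zero             (i , j , k) = cong (λ x → x , j , k) (inc⁻¹-inc i)
  shift⁻¹-shift (suc zero)       (i , j , k) = cong (λ x → i , x , k) (inc⁻¹-inc j)
  shift⁻¹-shift (suc (suc zero)) (i , j , k) = cong (λ x → i , j , x) (inc⁻¹-inc k)

  shift-bijective : ∀ d → Bijective _≡_ _≡_ (shift m d)
  shift-bijective d =
    Bijection.bijective (↔⇒⤖ (mk↔ₛ′ (shift m d) (shift⁻¹ d) (shift-shift⁻¹ d) (shift⁻¹-shift d)))

  coordinateSum : V m → ℕ
  coordinateSum (i , j , k) = toℕ i + toℕ j + toℕ k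

  level : V m → Fin m
  level v = coordinateSum v mod m

  toℕ-inc-% : ∀ x → toℕ (inc m x) % m ≡ (toℕ x + 1) % m
  toℕ-inc-% x = trans (cong (_% m) (toℕ-inc x)) (m%n%n≡m%n (toℕ x + 1) m)

  coordinateSum-shift : ∀ d v → coordinateSum (shift m d v) % m ≡ (coordinateSum v + 1) % m
  coordinateSum-shift zero (i , j , k) =
    trans (+-cong-% m (+-cong-% m (toℕ-inc-% i) refl) refl)
          (cong (_% m) (rearrange (toℕ i) (toℕ j) (toℕ k)))
    where
    rearrange : ∀ a b c → a + 1 + b + c ≡ a + b + c + 1
    rearrange = solve-∀
  coordinateSum-shift (suc zero) (i , j , k) =
    trans (+-cong-% m (+-cong-% m (refl {x = toℕ i % m}) (toℕ-inc-% j)) refl)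
          (cong (_% m) (rearrange (toℕ i) (toℕ j) (toℕ k)))
    where
    rearrange : ∀ a b c → a + (b + 1) + c ≡ a + b + c + 1
    rearrange = solve-∀
  coordinateSum-shift (suc (suc zero)) (i , j , k) =
    trans (+-cong-% m refl (toℕ-inc-% k)) (cong (_% m) (sym (+-assoc (toℕ i + toℕ j) (toℕ k) 1)))

  level-shift : ∀ d v → level (shift m d v) ≡ inc m (level v)
  level-shift d v = toℕ-injective (begin
    toℕ (level (shift m d v))        ≡⟨ toℕ-fromℕ< _ ⟩
    coordinateSum (shift m d v) % m  ≡⟨ coordinateSum-shift d v ⟩
    (coordinateSum v + 1) % m        ≡⟨ +-cong-% m (m%n%n≡m%n (coordinateSum v) m) refl ⟨
    (coordinateSum v % m + 1) % m    ≡⟨ cong (λ a → (a + 1) % m) (toℕ-fromℕ< _) ⟨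
    (toℕ (level v) + 1) % m          ≡⟨ toℕ-inc (level v) ⟨
    toℕ (inc m (level v))            ∎)

  S-cancel-shift : ∀ {d d′ v w} → shift m d w ≡ shift m d′ v → S m w ≡ S m v
  S-cancel-shift {d} {d′} {v} {w} arcs≡ = cong toℕ (inc-injective (begin
    inc m (level w)         ≡⟨ level-shift d w ⟨
    level (shift m d w)     ≡⟨ cong level arcs≡ ⟩
    level (shift m d′ v)    ≡⟨ level-shift d′ v ⟩
    inc m (level v)         ∎))

  ColorsOutArcsAt : Triple m → V m → Set
  ColorsOutArcsAt f v = (∀ c → ∃ λ d → f c v ≡ shift m d v) × (∀ d → ∃ λ c → f c v ≡ shift m d v)

  canonical-isColoring : IsColoring m (canonical m)
  canonical-isColoring = shift-bijective , λ v → (λ c → c , refl) , (λ d → d , refl)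

  kempeStep-preserves-S : ∀ {f r s v w} → IsColoring m f → KempeStep m f r s v w → S m w ≡ S m v
  kempeStep-preserves-S {r = r} {s} {v} {w} (_ , out) fsw≡frv with proj₁ (out w) s | proj₁ (out v) r
  ... | _ , fsw≡ | _ , frv≡ = S-cancel-shift (trans (sym fsw≡) (trans fsw≡frv frv≡))

  colorsOutArcsAt-permute : ∀ {f g v} (π : Permutation′ 3) → (∀ c → g c v ≡ f (π ⟨$⟩ʳ c) v) →
    ColorsOutArcsAt f v → ColorsOutArcsAt g v
  colorsOutArcsAt-permute {f} {g} {v} π g≡f∘π (out , onto) = out′ , onto′
    where
    out′ : ∀ c → ∃ λ d → g c v ≡ shift m d v
    out′ c with out (π ⟨$⟩ʳ c)
    ... | d , fπc≡ = d , trans (g≡f∘π c) fπc≡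
    onto′ : ∀ d → ∃ λ c → g c v ≡ shift m d v
    onto′ d with onto d
    ... | c , fc≡ = π ⟨$⟩ˡ c , trans (g≡f∘π (π ⟨$⟩ˡ c)) (trans (cong (λ c′ → f c′ v) (inverseʳ π)) fc≡)

  module _ {r s : Fin 3} {X : V m → Bool} {f : Triple m} where

    swap-outside : ∀ {c v} → X v ≡ false → swap m r s X f c v ≡ f c v
    swap-outside v∉X rewrite v∉X = refl

    swap-inside : ∀ {c v} → X v ≡ true → swap m r s X f c v ≡ f (transpose r s ⟨$⟩ʳ c) v
    swap-inside {c} v∈X rewrite v∈X with c ≟ r
    ... | yes _ = refl
    ... | no _ with c ≟ s
    ...   | yes _ = refl
    ...   | no _  = refl

    swap-compatible : (∀ c → Injective _≡_ _≡_ (f c)) → UnionOfCycles m f r s X →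
      ∀ c {v w} → f (transpose r s ⟨$⟩ʳ c) w ≡ f c v → X v ≡ X w
    swap-compatible inj U c {v} {w} e = by-cases (c ≟ r) (c ≟ s)
      where
      by-cases : Dec (c ≡ r) → Dec (c ≡ s) → X v ≡ X w
      by-cases (yes c≡r) _ =
        U v w (subst₂ (λ d d′ → f d w ≡ f d′ v) (transpose-matchˡ c≡r) c≡r e)
      by-cases (no _) (yes c≡s) =
        sym (U w v (sym (subst₂ (λ d d′ → f d w ≡ f d′ v) (transpose-matchʳ c≡s) c≡s e)))
      by-cases (no c≢r) (no c≢s) =
        cong X (sym (inj c (subst (λ d → f d w ≡ f c v) (transpose-fixes c≢r c≢s) e)))

    swap-colorsOutArcsAt : ∀ {v} → ColorsOutArcsAt f v → ColorsOutArcsAt (swap m r s X f) v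
    swap-colorsOutArcsAt {v} = by-membership (X v) refl
      where
      by-membership : ∀ b → X v ≡ b → ColorsOutArcsAt f v → ColorsOutArcsAt (swap m r s X f) v
      by-membership true  v∈X =
        colorsOutArcsAt-permute {f} {swap m r s X f} (transpose r s) (λ c → swap-inside {c} v∈X)
      by-membership false v∉X =
        colorsOutArcsAt-permute {f} {swap m r s X f} idₚ (λ c → swap-outside {c} v∉X)

    swap-isColoring : IsColoring m f → UnionOfCycles m f r s X → IsColoring m (swap m r s X f)
    swap-isColoring (bij , out) U =
      (λ c → select-bijective X {h = swap m r s X f c} (bij (transpose r s ⟨$⟩ʳ c)) (bij c)
               (swap-compatible (proj₁ ∘ bij) U c) swap-inside swap-outside) ,
      (λ v → swap-colorsOutArcsAt (out v))

  module _ {f : Triple m} (col : IsColoring m f) (r s : Fin 3) where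

    levelSet-unionOfCycles : (g : ℕ → Bool) → UnionOfCycles m f r s (λ v → g (S m v))
    levelSet-unionOfCycles g v w st = cong g (sym (kempeStep-preserves-S col st))

    levelSlice-unionOfCycles : ∀ n (h : V m → Bool) →
      (∀ {v w} → KempeStep m f r s v w → S m v ≡ n → h v ≡ h w) →
      UnionOfCycles m f r s (λ v → ⌊ S m v ℕ.≟ n ⌋ ∧ h v)
    levelSlice-unionOfCycles n h h-preserved v w st
      rewrite kempeStep-preserves-S col st with S m v ℕ.≟ n
    ... | yes Sv≡n = h-preserved st Sv≡n
    ... | no _     = refl

  K₀ : V m → Bool
  K₀ (_ , _ , k) = isZero m (toℕ k)

  kempe₀₁-canonical-preserves-K₀ : ∀ {v w} → KempeStep m (canonical m) zero (suc zero) v w → K₀ v ≡ K₀ w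
  kempe₀₁-canonical-preserves-K₀ st = sym (cong K₀ st)

  c3-agrees-off-P₀ : ∀ c x → P₀ m x ≡ false → c3 m c x ≡ canonical m c x
  c3-agrees-off-P₀ c x x∉P₀ = begin
    c3 m c x  ≡⟨ swap-outside {zero} {suc zero} {P₀ m} {c2 m} x∉P₀ ⟩
    c2 m c x  ≡⟨ swap-outside {zero} {suc (suc zero)} {P₀ m} {c1 m} x∉P₀ ⟩
    c1 m c x  ≡⟨ swap-outside {zero} {suc zero} {L₀ m} {c0 m} (cong (_∧ K₀ x) x∉P₀) ⟩
    c0 m c x  ∎

  c3-kempe₀₁-on-P₁-preserves-K₀ : IsColoring m (c3 m) → ∀ {v w} →
    KempeStep m (c3 m) zero (suc zero) v w → S m v ≡ 1 → K₀ v ≡ K₀ w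
  c3-kempe₀₁-on-P₁-preserves-K₀ col {v} {w} st Sv≡1 =
    kempe₀₁-canonical-preserves-K₀ (begin
    shift m (suc zero) w  ≡⟨ c3-agrees-off-P₀ (suc zero) w (off-P₀ w Sw≡1) ⟨
    c3 m (suc zero) w     ≡⟨ st ⟩
    c3 m zero v           ≡⟨ c3-agrees-off-P₀ zero v (off-P₀ v Sv≡1) ⟩
    shift m zero v        ∎)
    where
    Sw≡1 : S m w ≡ 1
    Sw≡1 = trans (kempeStep-preserves-S {r = zero} {suc zero} col st) Sv≡1
    off-P₀ : ∀ x → S m x ≡ 1 → P₀ m x ≡ false
    off-P₀ _ = cong (isZero m)

theorem3p1 : (m : ℕ) .{{_ : NonZero m}} → 3 ≤ m → Claim m
theorem3p1 m _ = (col₀ , uc₀) , (col₁ , uc₁) , (col₂ , uc₂) , (col₃ , uc₃) , (col₄ , uc₄) , col₅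
  where
  col₀ : IsColoring m (c0 m)
  col₀ = canonical-isColoring m
  uc₀ : UnionOfCycles m (c0 m) zero (suc zero) (L₀ m)
  uc₀ = levelSlice-unionOfCycles m col₀ zero (suc zero) 0 (K₀ m)
          (λ st _ → kempe₀₁-canonical-preserves-K₀ m st)
  col₁ : IsColoring m (c1 m)
  col₁ = swap-isColoring m col₀ uc₀
  uc₁ : UnionOfCycles m (c1 m) zero (suc (suc zero)) (P₀ m)
  uc₁ = levelSet-unionOfCycles m col₁ zero (suc (suc zero)) (isZero m)
  col₂ : IsColoring m (c2 m)
  col₂ = swap-isColoring m col₁ uc₁
  uc₂ : UnionOfCycles m (c2 m) zero (suc zero) (P₀ m)
  uc₂ = levelSet-unionOfCycles m col₂ zero (suc zero) (isZero m)
  col₃ : IsColoring m (c3 m)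
  col₃ = swap-isColoring m col₂ uc₂
  uc₃ : UnionOfCycles m (c3 m) zero (suc zero) (L₁ m)
  uc₃ = levelSlice-unionOfCycles m col₃ zero (suc zero) 1 (K₀ m)
          (c3-kempe₀₁-on-P₁-preserves-K₀ m col₃)
  col₄ : IsColoring m (c4 m)
  col₄ = swap-isColoring m col₃ uc₃
  uc₄ : UnionOfCycles m (c4 m) zero (suc (suc zero)) (P₁ m)
  uc₄ = levelSet-unionOfCycles m col₄ zero (suc (suc zero)) (isOne m)
  col₅ : IsColoring m (c5 m)
  col₅ = swap-isColoring m col₄ uc₄
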